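{- The integrality gap of the linear programming relaxation described in the context is at least $3$; that is, for every $\rho<3$ there is an instance $I$ of the capacitated tree cover problem with edge loads with $\mathrm{OPT}(I)>\rho\cdot\mathrm{OPT}_{LP}(I)$.
   Context: Capacitated tree cover problem with edge loads: given a complete graph $G=(V,E)$, metric edge costs $c:E\to\mathbb{R}_+$, vertex loads $b:V\to[0,1)$, metric edge loads $u:E\to\mathbb{R}_{\ge0}$ with $u(e)<u(f)\Rightarrow c(e)\le c(f)$, and $\gamma\ge0$, find $k\ge1$ and a spanning forest $F$ of $G$ with $k$ trees $T_1,\dots,T_k$, each with $\sum_{e\in E(T_i)}u(e)+\sum_{v\in V(T_i)}b(v)\le1$, minimizing $\sum_{e\in E(F)}c(e)+\gamma k$; $\mathrm{OPT}(I)$ is the optimum value. LP relaxation: minimize $\sum_{e\in E}c(e)x(e)+\gamma(|V|-x(E))$ subject to $x(E(G[A]))\le|A|-1$ for all $A\subseteq V$, $\sum_{e\in E(G[A])}(1+u(e))x(e)\le|A|-b(A)$ for all $A\subseteq V$, and $0\le x(e)\le 1$ for all $e\in E$, where $E(G[A])$ is the set of edges with both endpoints in $A$, $x(F)=\sum_{e\in F}x(e)$ and $b(A)=\sum_{v\in A}b(v)$; $\mathrm{OPT}_{LP}(I)$ is its optimum value. The integrality gap is $\sup_I \mathrm{OPT}(I)/\mathrm{OPT}_{LP}(I)$.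
   Formalization: The bound ρ ranges only over the rationals, and the edge costs, edge loads, vertex loads, γ and the feasible LP solution witnessing the gap are taken in ℚ. -}

module Defs where

open import Data.Nat using (ℕ; zero; suc)
open import Data.Integer using (+_)
open import Data.Fin using (Fin; _<_) renaming (zero to fz; suc to fs)
open import Data.Fin.Properties using (_<?_) renaming (_≟_ to _≟F_)
open import Data.Fin.Subset using (Subset; Nonempty)
open import Data.Fin.Subset.Properties using (_∈?_)
open import Data.Bool using (Bool; true; false; if_then_else_; _∧_; not)
open import Data.Rational using (ℚ; 0ℚ; 1ℚ; _+_; _*_; _-_; _/_)
  renaming (_≤_ to _≤ℚ_; _<_ to _<ℚ_)
open import Data.Product using (Σ; ∃; _×_; _,_)
open import Data.Sum using (_⊎_)
open import Relation.Binary.PropositionalEquality using (_≡_)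
open import Relation.Nullary using (¬_)
open import Relation.Nullary.Decidable using (⌊_⌋)
open import Function.Bundles using (_⇔_)

ℕ→ℚ : ℕ → ℚ
ℕ→ℚ n = + n / 1

sumFin : (n : ℕ) → (Fin n → ℚ) → ℚ
sumFin zero    f = 0ℚ
sumFin (suc n) f = f fz + sumFin n (λ i → f (fs i))

-- sum over the edges of the complete graph K_n; edge {i,j} is
-- represented by the ordered pair (i , j) with i < j
edgeSum : (n : ℕ) → (Fin n → Fin n → ℚ) → ℚ
edgeSum n f = sumFin n (λ i → sumFin n (λ j →
  if ⌊ i <? j ⌋ then f i j else 0ℚ))

restrict : Bool → ℚ → ℚ
restrict β q = if β then q else 0ℚ

record IsMetric (n : ℕ) (d : Fin n → Fin n → ℚ) : Set where
  field
    nonneg   : ∀ i j → 0ℚ ≤ℚ d i j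
    diag     : ∀ i → d i i ≡ 0ℚ
    symm     : ∀ i j → d i j ≡ d j i
    triangle : ∀ i j l → d i j ≤ℚ (d i l + d l j)

record Instance (n : ℕ) : Set where
  field
    c      : Fin n → Fin n → ℚ
    u      : Fin n → Fin n → ℚ
    b      : Fin n → ℚ
    γ      : ℚ
    c-metric : IsMetric n c
    u-metric : IsMetric n u
    b-range  : ∀ v → (0ℚ ≤ℚ b v) × (b v <ℚ 1ℚ)
    γ-nonneg : 0ℚ ≤ℚ γ
    monotone : ∀ i j k l → ¬ (i ≡ j) → ¬ (k ≡ l) →
               u i j <ℚ u k l → c i j ≤ℚ c k l

-- Forests.  An edge set F ⊆ E(K_n) is a Boolean function on pairs;
-- only pairs (i , j) with i < j are meaningful (edge {i,j}).

EdgeSet : ℕ → Set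
EdgeSet n = Fin n → Fin n → Bool

HasEdge : ∀ {n} → EdgeSet n → Fin n → Fin n → Set
HasEdge F i j = (i < j × F i j ≡ true) ⊎ (j < i × F j i ≡ true)

data Conn {n : ℕ} (F : EdgeSet n) : Fin n → Fin n → Set where
  here : ∀ {v} → Conn F v v
  step : ∀ {v w x} → HasEdge F v w → Conn F w x → Conn F v x

removeEdge : ∀ {n} → EdgeSet n → Fin n → Fin n → EdgeSet n
removeEdge F i j a b' = F a b' ∧ not (⌊ a ≟F i ⌋ ∧ ⌊ b' ≟F j ⌋)

Acyclic : ∀ {n} → EdgeSet n → Set
Acyclic {n} F = ∀ (i j : Fin n) → i < j → F i j ≡ true →
  ¬ Conn (removeEdge F i j) i j

-- F is a spanning forest of K_n whose k trees are the vertex classes of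
-- comp : Fin n → Fin k (comp v = index of the tree containing v)
record SpanningForest (n k : ℕ) (F : EdgeSet n) (comp : Fin n → Fin k) : Set where
  field
    acyclic    : Acyclic F
    surjective : ∀ (t : Fin k) → ∃ λ v → comp v ≡ t
    components : ∀ (v w : Fin n) → (comp v ≡ comp w) ⇔ Conn F v w

module _ {n : ℕ} (I : Instance n) where
  open Instance I

  treeLoad : ∀ {k} → EdgeSet n → (Fin n → Fin k) → Fin k → ℚ
  treeLoad F comp t =
    edgeSum n (λ i j → restrict (F i j ∧ ⌊ comp i ≟F t ⌋) (u i j))
    + sumFin n (λ v → restrict ⌊ comp v ≟F t ⌋ (b v))

  record TreeCover (k : ℕ) (F : EdgeSet n) (comp : Fin n → Fin k) : Set where
    field
      forest   : SpanningForest n k F comp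
      capacity : ∀ (t : Fin k) → treeLoad F comp t ≤ℚ 1ℚ

  coverCost : (k : ℕ) → EdgeSet n → ℚ
  coverCost k F = edgeSum n (λ i j → restrict (F i j) (c i j)) + γ * ℕ→ℚ k

  -- LP relaxation.  x i j (i < j) is the value of edge {i,j}.

  inducedSum : Subset n → (Fin n → Fin n → ℚ) → ℚ
  inducedSum A f = edgeSum n (λ i j →
    restrict (⌊ i ∈? A ⌋ ∧
              ⌊ j ∈? A ⌋) (f i j))

  size : Subset n → ℚ
  size A = sumFin n (λ v → restrict ⌊ v ∈? A ⌋ 1ℚ)

  bSum : Subset n → ℚ
  bSum A = sumFin n (λ v → restrict ⌊ v ∈? A ⌋ (b v))

  record LPFeasible (x : Fin n → Fin n → ℚ) : Set where
    field
      forestIneq : ∀ (A : Subset n) → Nonempty A →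
                   inducedSum A x ≤ℚ (size A - 1ℚ)
      loadIneq   : ∀ (A : Subset n) →
                   inducedSum A (λ i j → (1ℚ + u i j) * x i j) ≤ℚ (size A - bSum A)
      bounds     : ∀ (i j : Fin n) → i < j → (0ℚ ≤ℚ x i j) × (x i j ≤ℚ 1ℚ)

  lpValue : (Fin n → Fin n → ℚ) → ℚ
  lpValue x = edgeSum n (λ i j → c i j * x i j) + γ * (ℕ→ℚ n - edgeSum n x)

-- Take the star K_{1,m} with zero costs, zero vertex loads, γ = 1 and the tree metric in which
-- every spoke has load s, so two distinct leaves are at load distance 2s. If 2s > 1, no tree of
-- a cover can contain a leaf–leaf edge or two spokes, hence all leaves lie in different trees and
-- every cover costs at least m. The LP, however, may put weight y on every spoke as long as
-- (1 + s) y ≤ 1, at cost 1 + m (1 - y). As s ↓ 1/2 and y ↑ 2/3 this is about m/3, so the ratio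
-- tends to 3. A rational ρ < 3 with denominator d + 1 satisfies ρ ≤ 3 - 1/(d+1), and that margin
-- is enough for explicit choices of s, y and m.
module Submission where

open import Defs
open import Data.Nat using (ℕ; _≤_)
open import Data.Fin using (Fin)
open import Data.Rational using (ℚ; _<_; _*_)
open import Data.Product using (Σ; _×_)

open import Data.Bool using (true; false; _∧_)
open import Data.Empty using (⊥; ⊥-elim)
open import Data.Fin as Fin using () renaming (zero to fz; suc to fs)
open import Data.Fin.Properties using (_≟_; _<?_; <⇒≢; suc-injective; injective⇒≤)
open import Data.Fin.Subset using (Subset; Nonempty)
open import Data.Fin.Subset.Properties using (_∈?_)
open import Data.Integer as ℤ using (+_)
import Data.Integer.Properties as ℤP
import Data.Integer.Solver as ℤSolver
open import Data.Nat as ℕ using (zero; suc; s≤s; z≤n)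
import Data.Nat.Coprimality as Coprimality
import Data.Nat.Properties as ℕP
open import Data.Product using (_,_; proj₁)
open import Data.Rational as ℚ using (mkℚ; 0ℚ; 1ℚ; _+_; _-_; -_; _/_) renaming (_≤_ to _≤ℚ_)
import Data.Rational.Properties as ℚP
import Data.Rational.Solver as ℚSolver
import Data.Rational.Unnormalised as ℚᵘ
import Data.Rational.Unnormalised.Properties as ℚᵘP
open import Data.Sum using (inj₁; inj₂)
open import Data.Vec using (_∷_)
open import Function using (_∘_)
open import Function.Bundles using (Equivalence)
open import Relation.Binary.PropositionalEquality
open import Relation.Nullary using (Dec; yes; no; ¬_)
open import Relation.Nullary.Decidable using (⌊_⌋)

open ℚP.≤-Reasoning

p≤p+q : ∀ p {q} → 0ℚ ≤ℚ q → p ≤ℚ p + q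
p≤p+q p {q} 0≤q = subst (_≤ℚ p + q) (ℚP.+-identityʳ p) (ℚP.+-monoʳ-≤ p 0≤q)

q≤p+q : ∀ {p} q → 0ℚ ≤ℚ p → q ≤ℚ p + q
q≤p+q {p} q 0≤p = subst (_≤ℚ p + q) (ℚP.+-identityˡ q) (ℚP.+-monoˡ-≤ q 0≤p)

p-q≤p : ∀ p {q} → 0ℚ ≤ℚ q → p - q ≤ℚ p
p-q≤p p {q} 0≤q = subst (p - q ≤ℚ_) (ℚP.+-identityʳ p) (ℚP.+-monoʳ-≤ p (ℚP.neg-antimono-≤ 0≤q))

p-q<p : ∀ p {q} → 0ℚ < q → p - q < p
p-q<p p {q} 0<q = subst (p - q <_) (ℚP.+-identityʳ p) (ℚP.+-monoʳ-< p (ℚP.neg-antimono-< 0<q))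

0≤p-q : ∀ {p q} → q ≤ℚ p → 0ℚ ≤ℚ p - q
0≤p-q {p} {q} q≤p = subst (_≤ℚ p - q) (ℚP.+-inverseʳ q) (ℚP.+-monoˡ-≤ (- q) q≤p)

0≤p*q : ∀ {p q} → 0ℚ ≤ℚ p → 0ℚ ≤ℚ q → 0ℚ ≤ℚ p * q
0≤p*q {p} {q} 0≤p 0≤q =
  subst (_≤ℚ p * q) (ℚP.*-zeroˡ q) (ℚP.*-monoʳ-≤-nonNeg q {{ℚ.nonNegative 0≤q}} 0≤p)

0≤1 : 0ℚ ≤ℚ 1ℚ
0≤1 = ℚP.nonNegative⁻¹ 1ℚ

1+p-1≡p : ∀ p → (1ℚ + p) - 1ℚ ≡ p
1+p-1≡p p = solve 1 (λ x → (con 1ℚ :+ x) :- con 1ℚ := x) refl p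
  where open ℚSolver.+-*-Solver

p+q≤r⇒p≤r-q : ∀ {p q r} → p + q ≤ℚ r → p ≤ℚ r - q
p+q≤r⇒p≤r-q {p} {q} {r} p+q≤r = begin
  p              ≡⟨ solve 2 (λ p q → p := (p :+ q) :- q) refl p q ⟩
  (p + q) - q    ≤⟨ ℚP.+-monoˡ-≤ (- q) p+q≤r ⟩
  r - q          ∎
  where open ℚSolver.+-*-Solver

coprimeTo1 : ∀ n → Coprimality.Coprime n 1
coprimeTo1 n = Coprimality.sym (Coprimality.1-coprimeTo n)

ℕ→ℚ-canonical : ∀ n → ℕ→ℚ n ≡ mkℚ (+ n) 0 (coprimeTo1 n)
ℕ→ℚ-canonical n = ℚP.normalize-coprime (coprimeTo1 n)

ℕ→ℚ-+ : ∀ a b → ℕ→ℚ (a ℕ.+ b) ≡ ℕ→ℚ a + ℕ→ℚ b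
ℕ→ℚ-+ a b = trans (cong (_/ 1) numerators) (sym (cong₂ _+_ (ℕ→ℚ-canonical a) (ℕ→ℚ-canonical b)))
  where
  numerators : + (a ℕ.+ b) ≡ + a ℤ.* + 1 ℤ.+ + b ℤ.* + 1
  numerators = sym (cong₂ ℤ._+_ (ℤP.*-identityʳ (+ a)) (ℤP.*-identityʳ (+ b)))

ℕ→ℚ-* : ∀ a b → ℕ→ℚ (a ℕ.* b) ≡ ℕ→ℚ a * ℕ→ℚ b
ℕ→ℚ-* a b = trans (cong (_/ 1) (ℤP.pos-* a b)) (sym (cong₂ _*_ (ℕ→ℚ-canonical a) (ℕ→ℚ-canonical b)))

ℕ→ℚ-mono : ∀ {a b} → a ≤ b → ℕ→ℚ a ≤ℚ ℕ→ℚ b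
ℕ→ℚ-mono {a} {b} a≤b rewrite ℕ→ℚ-canonical a | ℕ→ℚ-canonical b =
  ℚ.*≤* (ℤP.*-monoʳ-≤-nonNeg (+ 1) (ℤ.+≤+ a≤b))

-- 1/(d+1): mkℚ stores the denominator minus one.
unitFraction : ℕ → ℚ
unitFraction d = mkℚ (+ 1) d (Coprimality.1-coprimeTo (suc d))

unitFraction-inverse : ∀ d → ℕ→ℚ (suc d) * unitFraction d ≡ 1ℚ
unitFraction-inverse d rewrite ℕ→ℚ-canonical (suc d) =
  ℚP.*-inverseʳ (mkℚ (+ suc d) 0 (coprimeTo1 (suc d)))

0<unitFraction : ∀ d → 0ℚ < unitFraction d
0<unitFraction d = ℚ.*<* (ℤ.+<+ (s≤s z≤n))

unitFraction≤1 : ∀ d → unitFraction d ≤ℚ 1ℚ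
unitFraction≤1 d = ℚ.*≤* (ℤ.+≤+ (s≤s z≤n))

-- p = P/D < N means P < N D in ℤ, hence P + 1 ≤ N D, i.e. p + 1/D ≤ N.
<ℕ⇒+unitFraction≤ℕ : ∀ {p} N → p < ℕ→ℚ N → p + unitFraction (ℚ.denominator-1 p) ≤ℚ ℕ→ℚ N
<ℕ⇒+unitFraction≤ℕ {p@(mkℚ P d _)} N p<N rewrite ℕ→ℚ-canonical N with p<N
... | ℚ.*<* P<ND = ℚP.toℚᵘ-cancel-≤
  (ℚᵘP.≤-respˡ-≃ (ℚᵘP.≃-sym (ℚP.toℚᵘ-homo-+ p (unitFraction d))) (ℚᵘ.*≤* cross))
  where
  open ℤSolver.+-*-Solver
  D : ℤ.ℤ
  D = + suc d
  cross : (P ℤ.* D ℤ.+ + 1 ℤ.* D) ℤ.* + 1 ℤ.≤ + N ℤ.* + (suc d ℕ.* suc d)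
  cross = subst₂ ℤ._≤_
    (solve 2 (λ P D → (con (+ 1) :+ P :* con (+ 1)) :* D
                      := (P :* D :+ con (+ 1) :* D) :* con (+ 1)) refl P D)
    (trans (ℤP.*-assoc (+ N) D D) (cong (+ N ℤ.*_) (sym (ℤP.pos-* (suc d) (suc d)))))
    (ℤP.*-monoʳ-≤-nonNeg D (ℤP.i<j⇒suc[i]≤j P<ND))

restrict-zero : ∀ β {q} → q ≡ 0ℚ → restrict β q ≡ 0ℚ
restrict-zero true  q≡0 = q≡0
restrict-zero false _   = refl

restrict-yes : ∀ {P : Set} (P? : Dec P) {q} → P → restrict ⌊ P? ⌋ q ≡ q
restrict-yes (yes _) _ = refl
restrict-yes (no ¬p) p = ⊥-elim (¬p p)

restrict-nonneg : ∀ β {q} → 0ℚ ≤ℚ q → 0ℚ ≤ℚ restrict β q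
restrict-nonneg true  0≤q = 0≤q
restrict-nonneg false _   = ℚP.≤-refl

restrict-mono : ∀ β {p q} → p ≤ℚ q → restrict β p ≤ℚ restrict β q
restrict-mono true  p≤q = p≤q
restrict-mono false _   = ℚP.≤-refl

sumFin-zero : ∀ n {f : Fin n → ℚ} → (∀ i → f i ≡ 0ℚ) → sumFin n f ≡ 0ℚ
sumFin-zero zero    _     = refl
sumFin-zero (suc n) f≡0 = cong₂ _+_ (f≡0 fz) (sumFin-zero n (λ i → f≡0 (fs i)))

sumFin-const : ∀ n q → sumFin n (λ _ → q) ≡ ℕ→ℚ n * q
sumFin-const zero    q = sym (ℚP.*-zeroˡ q)
sumFin-const (suc n) q = begin-equality
  q + sumFin n (λ _ → q)  ≡⟨ cong₂ _+_ (sym (ℚP.*-identityˡ q)) (sumFin-const n q) ⟩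
  1ℚ * q + ℕ→ℚ n * q      ≡⟨ ℚP.*-distribʳ-+ q 1ℚ (ℕ→ℚ n) ⟨
  (1ℚ + ℕ→ℚ n) * q        ≡⟨ cong (_* q) (ℕ→ℚ-+ 1 n) ⟨
  ℕ→ℚ (suc n) * q         ∎

sumFin-mono : ∀ n {f g : Fin n → ℚ} → (∀ i → f i ≤ℚ g i) → sumFin n f ≤ℚ sumFin n g
sumFin-mono zero    _   = ℚP.≤-refl
sumFin-mono (suc n) f≤g = ℚP.+-mono-≤ (f≤g fz) (sumFin-mono n (λ i → f≤g (fs i)))

sumFin-nonneg : ∀ n {f : Fin n → ℚ} → (∀ i → 0ℚ ≤ℚ f i) → 0ℚ ≤ℚ sumFin n f
sumFin-nonneg zero    _   = ℚP.≤-refl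
sumFin-nonneg (suc n) 0≤f = ℚP.+-mono-≤ (0≤f fz) (sumFin-nonneg n (λ i → 0≤f (fs i)))

term≤sumFin : ∀ n {f : Fin n → ℚ} → (∀ i → 0ℚ ≤ℚ f i) → ∀ a → f a ≤ℚ sumFin n f
term≤sumFin (suc n) {f} 0≤f fz     = p≤p+q (f fz) (sumFin-nonneg n (λ i → 0≤f (fs i)))
term≤sumFin (suc n) {f} 0≤f (fs a) =
  ℚP.≤-trans (term≤sumFin n (λ i → 0≤f (fs i)) a) (q≤p+q _ (0≤f fz))

twoTerms≤sumFin : ∀ n {f : Fin n → ℚ} → (∀ i → 0ℚ ≤ℚ f i) →
               ∀ {a b} → a ≢ b → f a + f b ≤ℚ sumFin n f
twoTerms≤sumFin (suc n)     0≤f {fz}   {fz}   a≢b = ⊥-elim (a≢b refl)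
twoTerms≤sumFin (suc n) {f} 0≤f {fz}   {fs b} _   =
  ℚP.+-monoʳ-≤ (f fz) (term≤sumFin n (λ i → 0≤f (fs i)) b)
twoTerms≤sumFin (suc n) {f} 0≤f {fs a} {fz}   _   =
  subst (_≤ℚ sumFin (suc n) f) (ℚP.+-comm (f fz) (f (fs a)))
        (ℚP.+-monoʳ-≤ (f fz) (term≤sumFin n (λ i → 0≤f (fs i)) a))
twoTerms≤sumFin (suc n) {f} 0≤f {fs a} {fs b} a≢b =
  ℚP.≤-trans (twoTerms≤sumFin n (λ i → 0≤f (fs i)) (a≢b ∘ cong fs)) (q≤p+q _ (0≤f fz))

module _ (n : ℕ) {g : Fin n → Fin n → ℚ} (0≤g : ∀ i j → 0ℚ ≤ℚ g i j) where

  private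
    row : Fin n → Fin n → ℚ
    row i j = restrict ⌊ i <? j ⌋ (g i j)

    0≤row : ∀ i j → 0ℚ ≤ℚ row i j
    0≤row i j = restrict-nonneg ⌊ i <? j ⌋ (0≤g i j)

    rowSum≤edgeSum : ∀ i → sumFin n (row i) ≤ℚ edgeSum n g
    rowSum≤edgeSum = term≤sumFin n (λ i → sumFin-nonneg n (0≤row i))

    row-< : ∀ {i j} → i Fin.< j → row i j ≡ g i j
    row-< {i} {j} = restrict-yes (i <? j)

  edge≤edgeSum : ∀ {i j} → i Fin.< j → g i j ≤ℚ edgeSum n g
  edge≤edgeSum {i} {j} i<j = begin
    g i j             ≡⟨ row-< i<j ⟨
    row i j           ≤⟨ term≤sumFin n (0≤row i) j ⟩
    sumFin n (row i)  ≤⟨ rowSum≤edgeSum i ⟩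
    edgeSum n g       ∎

  twoEdges≤edgeSum : ∀ {i j j′} → i Fin.< j → i Fin.< j′ → j ≢ j′ → g i j + g i j′ ≤ℚ edgeSum n g
  twoEdges≤edgeSum {i} {j} {j′} i<j i<j′ j≢j′ = begin
    g i j + g i j′      ≡⟨ cong₂ _+_ (row-< i<j) (row-< i<j′) ⟨
    row i j + row i j′  ≤⟨ twoTerms≤sumFin n (0≤row i) j≢j′ ⟩
    sumFin n (row i)    ≤⟨ rowSum≤edgeSum i ⟩
    edgeSum n g         ∎

edgeSum-zero : ∀ n (g : Fin n → Fin n → ℚ) → (∀ i j → g i j ≡ 0ℚ) → edgeSum n g ≡ 0ℚ
edgeSum-zero n g g≡0 =
  sumFin-zero n (λ i → sumFin-zero n (λ j → restrict-zero ⌊ i <? j ⌋ (g≡0 i j)))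

edgeSum-spokes : ∀ m (g : Fin (suc m) → Fin (suc m) → ℚ) → (∀ i j → g (fs i) j ≡ 0ℚ) →
                 edgeSum (suc m) g ≡ sumFin m (λ j → g fz (fs j))
edgeSum-spokes m g g-spokes = begin-equality
  (0ℚ + spokes) + sumFin m (λ i → sumFin (suc m) (λ j → restrict ⌊ fs i <? j ⌋ (g (fs i) j)))
    ≡⟨ cong (λ rest → (0ℚ + spokes) + rest) (sumFin-zero m (λ i → sumFin-zero (suc m) (λ j →
         restrict-zero ⌊ fs i <? j ⌋ (g-spokes i j)))) ⟩
  (0ℚ + spokes) + 0ℚ  ≡⟨ ℚP.+-identityʳ _ ⟩
  0ℚ + spokes         ≡⟨ ℚP.+-identityˡ _ ⟩
  spokes              ∎
  where
  spokes : ℚ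
  spokes = sumFin m (λ j → g fz (fs j))

module _ {n} (I : Instance n) {k} {F : EdgeSet n} {comp : Fin n → Fin k}
         (cover : TreeCover I k F comp) where
  open Instance I

  private
    treeEdgeLoad : Fin k → Fin n → Fin n → ℚ
    treeEdgeLoad t i j = restrict (F i j ∧ ⌊ comp i ≟ t ⌋) (u i j)

    0≤treeEdgeLoad : ∀ t i j → 0ℚ ≤ℚ treeEdgeLoad t i j
    0≤treeEdgeLoad t i j = restrict-nonneg (F i j ∧ ⌊ comp i ≟ t ⌋) (IsMetric.nonneg u-metric i j)

    treeEdgeLoad-own : ∀ {i j} → F i j ≡ true → treeEdgeLoad (comp i) i j ≡ u i j
    treeEdgeLoad-own {i} Fij rewrite Fij = restrict-yes (comp i ≟ comp i) refl

    edgeLoad≤1 : ∀ t → edgeSum n (treeEdgeLoad t) ≤ℚ 1ℚ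
    edgeLoad≤1 t = begin
      edgeSum n (treeEdgeLoad t)  ≤⟨ p≤p+q _ (sumFin-nonneg n (λ v →
                                       restrict-nonneg ⌊ comp v ≟ t ⌋ (proj₁ (b-range v)))) ⟩
      treeLoad I F comp t         ≤⟨ TreeCover.capacity cover t ⟩
      1ℚ                          ∎

  coveredEdge-load≤1 : ∀ {i j} → i Fin.< j → F i j ≡ true → u i j ≤ℚ 1ℚ
  coveredEdge-load≤1 {i} {j} i<j Fij = begin
    u i j                             ≡⟨ treeEdgeLoad-own Fij ⟨
    treeEdgeLoad (comp i) i j         ≤⟨ edge≤edgeSum n (0≤treeEdgeLoad (comp i)) i<j ⟩
    edgeSum n (treeEdgeLoad (comp i)) ≤⟨ edgeLoad≤1 (comp i) ⟩
    1ℚ                                ∎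

  twoCoveredEdges-load≤1 : ∀ {i j j′} → i Fin.< j → i Fin.< j′ → j ≢ j′ →
                        F i j ≡ true → F i j′ ≡ true → u i j + u i j′ ≤ℚ 1ℚ
  twoCoveredEdges-load≤1 {i} {j} {j′} i<j i<j′ j≢j′ Fij Fij′ = begin
    u i j + u i j′
      ≡⟨ cong₂ _+_ (treeEdgeLoad-own Fij) (treeEdgeLoad-own Fij′) ⟨
    treeEdgeLoad (comp i) i j + treeEdgeLoad (comp i) i j′
      ≤⟨ twoEdges≤edgeSum n (0≤treeEdgeLoad (comp i)) i<j i<j′ j≢j′ ⟩
    edgeSum n (treeEdgeLoad (comp i))
      ≤⟨ edgeLoad≤1 (comp i) ⟩
    1ℚ
      ∎

-- The shortest-path metric of a star whose hub is not a point of the space: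
-- point i hangs at distance h i from the hub.
module _ {n : ℕ} (h : Fin n → ℚ) where

  hubDistance : Fin n → Fin n → ℚ
  hubDistance i j with i ≟ j
  ... | yes _ = 0ℚ
  ... | no  _ = h i + h j

  hubDistance-diag : ∀ i → hubDistance i i ≡ 0ℚ
  hubDistance-diag i with i ≟ i
  ... | yes _   = refl
  ... | no  i≢i = ⊥-elim (i≢i refl)

  hubDistance-≢ : ∀ {i j} → i ≢ j → hubDistance i j ≡ h i + h j
  hubDistance-≢ {i} {j} i≢j with i ≟ j
  ... | yes i≡j = ⊥-elim (i≢j i≡j)
  ... | no  _   = refl

  hubDistance-sym : ∀ i j → hubDistance i j ≡ hubDistance j i
  hubDistance-sym i j with i ≟ j | j ≟ i
  ... | yes _   | yes _   = refl
  ... | no  _   | no  _   = ℚP.+-comm (h i) (h j)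
  ... | yes i≡j | no  j≢i = ⊥-elim (j≢i (sym i≡j))
  ... | no  i≢j | yes j≡i = ⊥-elim (i≢j (sym j≡i))

  module _ (0≤h : ∀ i → 0ℚ ≤ℚ h i) where

    0≤hubDistance : ∀ i j → 0ℚ ≤ℚ hubDistance i j
    0≤hubDistance i j with i ≟ j
    ... | yes _ = ℚP.≤-refl
    ... | no  _ = ℚP.+-mono-≤ (0≤h i) (0≤h j)

    hubDistance≤ : ∀ i j → hubDistance i j ≤ℚ h i + h j
    hubDistance≤ i j with i ≟ j
    ... | yes _ = ℚP.+-mono-≤ (0≤h i) (0≤h j)
    ... | no  _ = ℚP.≤-refl

    hubDistance-triangle : ∀ i j l → hubDistance i j ≤ℚ hubDistance i l + hubDistance l j
    hubDistance-triangle i j l = via (i ≟ l) (l ≟ j)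
      where
      via : Dec (i ≡ l) → Dec (l ≡ j) → hubDistance i j ≤ℚ hubDistance i l + hubDistance l j
      via (yes refl) _ = ℚP.≤-reflexive (sym (trans
        (cong (_+ hubDistance i j) (hubDistance-diag i)) (ℚP.+-identityˡ _)))
      via _ (yes refl) = ℚP.≤-reflexive (sym (trans
        (cong (λ r → hubDistance i j + r) (hubDistance-diag j)) (ℚP.+-identityʳ _)))
      via (no i≢l) (no l≢j) = begin
        hubDistance i j                   ≤⟨ hubDistance≤ i j ⟩
        h i + h j                         ≤⟨ ℚP.+-mono-≤ (p≤p+q (h i) (0≤h l)) (q≤p+q (h j) (0≤h l)) ⟩
        (h i + h l) + (h l + h j)         ≡⟨ cong₂ _+_ (hubDistance-≢ i≢l) (hubDistance-≢ l≢j) ⟨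
        hubDistance i l + hubDistance l j ∎

    hubDistance-isMetric : IsMetric n hubDistance
    hubDistance-isMetric = record
      { nonneg   = 0≤hubDistance
      ; diag     = hubDistance-diag
      ; symm     = hubDistance-sym
      ; triangle = hubDistance-triangle
      }

zeroMetric : ∀ n → IsMetric n (λ _ _ → 0ℚ)
zeroMetric n = record
  { nonneg   = λ _ _ → ℚP.≤-refl
  ; diag     = λ _ → refl
  ; symm     = λ _ _ → refl
  ; triangle = λ _ _ _ → ℚP.≤-refl
  }

module _ {n} (I : Instance n) where

  0≤size : ∀ A → 0ℚ ≤ℚ size I A
  0≤size A = sumFin-nonneg n (λ v → restrict-nonneg ⌊ v ∈? A ⌋ 0≤1)

  1≤size : ∀ {A} → Nonempty A → 1ℚ ≤ℚ size I A
  1≤size {A} (v , v∈A) = begin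
    1ℚ                       ≡⟨ restrict-yes (v ∈? A) v∈A ⟨
    restrict ⌊ v ∈? A ⌋ 1ℚ   ≤⟨ term≤sumFin n (λ w → restrict-nonneg ⌊ w ∈? A ⌋ 0≤1) v ⟩
    size I A                 ∎

-- The star K_{1,m}: vertex fz is the centre and fs j is the j-th leaf.
module Star (m : ℕ) (s : ℚ) (0≤s : 0ℚ ≤ℚ s) where

  armLength : Fin (suc m) → ℚ
  armLength fz     = 0ℚ
  armLength (fs _) = s

  0≤armLength : ∀ v → 0ℚ ≤ℚ armLength v
  0≤armLength fz     = ℚP.≤-refl
  0≤armLength (fs _) = 0≤s

  star : Instance (suc m)
  star = record
    { c        = λ _ _ → 0ℚ
    ; u        = hubDistance armLength
    ; b        = λ _ → 0ℚ
    ; γ        = 1ℚ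
    ; c-metric = zeroMetric (suc m)
    ; u-metric = hubDistance-isMetric armLength 0≤armLength
    ; b-range  = λ _ → ℚP.≤-refl , ℚP.positive⁻¹ 1ℚ
    ; γ-nonneg = 0≤1
    ; monotone = λ _ _ _ _ _ _ _ → ℚP.≤-refl
    }

  spokeLoad : ∀ j → hubDistance armLength fz (fs j) ≡ s
  spokeLoad _ = ℚP.+-identityˡ s

  leafLoad : ∀ {a b} → a ≢ b → hubDistance armLength (fs a) (fs b) ≡ s + s
  leafLoad a≢b = hubDistance-≢ armLength (a≢b ∘ suc-injective)

  module _ (g : Fin (suc m) → Fin (suc m) → ℚ) (g-spokes : ∀ i j → g (fs i) j ≡ 0ℚ) where

    private
      inducedSum-spokes : ∀ A → inducedSum star A g ≡
        sumFin m (λ j → restrict (⌊ fz ∈? A ⌋ ∧ ⌊ fs j ∈? A ⌋) (g fz (fs j)))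
      inducedSum-spokes A = edgeSum-spokes m (λ i j → restrict (⌊ i ∈? A ⌋ ∧ ⌊ j ∈? A ⌋) (g i j))
        (λ i j → restrict-zero (⌊ fs i ∈? A ⌋ ∧ ⌊ j ∈? A ⌋) (g-spokes i j))

    inducedSum-withoutCentre : ∀ A → inducedSum star (false ∷ A) g ≡ 0ℚ
    inducedSum-withoutCentre A =
      trans (inducedSum-spokes (false ∷ A)) (sumFin-zero m (λ _ → refl))

    inducedSum-withCentre : (∀ j → g fz (fs j) ≤ℚ 1ℚ) →
                            ∀ A → inducedSum star (true ∷ A) g ≤ℚ size star (true ∷ A) - 1ℚ
    inducedSum-withCentre g≤1 A = begin
      inducedSum star A⁺ g
        ≡⟨ inducedSum-spokes A⁺ ⟩
      sumFin m (λ j → restrict ⌊ fs j ∈? A⁺ ⌋ (g fz (fs j)))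
        ≤⟨ sumFin-mono m (λ j → restrict-mono ⌊ fs j ∈? A⁺ ⌋ (g≤1 j)) ⟩
      leaves
        ≡⟨ 1+p-1≡p leaves ⟨
      (1ℚ + leaves) - 1ℚ
        ∎
      where
      A⁺ : Subset (suc m)
      A⁺ = true ∷ A
      -- Indexed through A⁺ so that size star A⁺ unfolds to 1ℚ + leaves; ⌊ fs j ∈? A⁺ ⌋
      -- does not reduce to ⌊ j ∈? A ⌋.
      leaves : ℚ
      leaves = sumFin m (λ j → restrict ⌊ fs j ∈? A⁺ ⌋ 1ℚ)

  spokeWeights : ℚ → Fin (suc m) → Fin (suc m) → ℚ
  spokeWeights y fz (fs _) = y
  spokeWeights y _  _      = 0ℚ

  module _ {y} (0≤y : 0ℚ ≤ℚ y) (y≤1 : y ≤ℚ 1ℚ) (spoke≤1 : (1ℚ + s) * y ≤ℚ 1ℚ) where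

    private
      loadWeights : Fin (suc m) → Fin (suc m) → ℚ
      loadWeights i j = (1ℚ + hubDistance armLength i j) * spokeWeights y i j

      loadWeights-spokes : ∀ i j → loadWeights (fs i) j ≡ 0ℚ
      loadWeights-spokes i j = ℚP.*-zeroʳ (1ℚ + hubDistance armLength (fs i) j)

      loadWeights≤1 : ∀ j → loadWeights fz (fs j) ≤ℚ 1ℚ
      loadWeights≤1 j = subst (λ r → (1ℚ + r) * y ≤ℚ 1ℚ) (sym (spokeLoad j)) spoke≤1

      forestIneq : ∀ A → Nonempty A → inducedSum star A (spokeWeights y) ≤ℚ size star A - 1ℚ
      forestIneq (true ∷ A)  _  =
        inducedSum-withCentre (spokeWeights y) (λ _ _ → refl) (λ _ → y≤1) A
      forestIneq (false ∷ A) ne = begin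
        inducedSum star (false ∷ A) (spokeWeights y)
          ≡⟨ inducedSum-withoutCentre (spokeWeights y) (λ _ _ → refl) A ⟩
        0ℚ
          ≤⟨ 0≤p-q (1≤size star ne) ⟩
        size star (false ∷ A) - 1ℚ
          ∎

      loadWeights≤size : ∀ A → inducedSum star A loadWeights ≤ℚ size star A
      loadWeights≤size (true ∷ A) = begin
        inducedSum star (true ∷ A) loadWeights
          ≤⟨ inducedSum-withCentre loadWeights loadWeights-spokes loadWeights≤1 A ⟩
        size star (true ∷ A) - 1ℚ              ≤⟨ p-q≤p _ 0≤1 ⟩
        size star (true ∷ A)                   ∎
      loadWeights≤size (false ∷ A) = begin
        inducedSum star (false ∷ A) loadWeights
          ≡⟨ inducedSum-withoutCentre loadWeights loadWeights-spokes A ⟩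
        0ℚ                                      ≤⟨ 0≤size star (false ∷ A) ⟩
        size star (false ∷ A)                   ∎

      loadIneq : ∀ A → inducedSum star A loadWeights ≤ℚ size star A - bSum star A
      loadIneq A = begin
        inducedSum star A loadWeights ≤⟨ loadWeights≤size A ⟩
        size star A                   ≡⟨ ℚP.+-identityʳ _ ⟨
        size star A - 0ℚ              ≡⟨ cong (λ r → size star A - r) bSum≡0 ⟨
        size star A - bSum star A     ∎
        where
        bSum≡0 : bSum star A ≡ 0ℚ
        bSum≡0 = sumFin-zero (suc m) (λ v → restrict-zero ⌊ v ∈? A ⌋ refl)

      bounds : ∀ i j → i Fin.< j → (0ℚ ≤ℚ spokeWeights y i j) × (spokeWeights y i j ≤ℚ 1ℚ)
      bounds fz     fz     _ = ℚP.≤-refl , 0≤1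
      bounds fz     (fs _) _ = 0≤y , y≤1
      bounds (fs _) _      _ = ℚP.≤-refl , 0≤1

    spokeWeights-feasible : LPFeasible star (spokeWeights y)
    spokeWeights-feasible = record
      { forestIneq = forestIneq
      ; loadIneq   = loadIneq
      ; bounds     = bounds
      }

  lpValue-spokeWeights : ∀ y → lpValue star (spokeWeights y) ≡ ℕ→ℚ (suc m) - ℕ→ℚ m * y
  lpValue-spokeWeights y = begin-equality
    edgeSum (suc m) (λ i j → 0ℚ * spokeWeights y i j)
      + 1ℚ * (ℕ→ℚ (suc m) - edgeSum (suc m) (spokeWeights y))
      ≡⟨ cong₂ (λ a b → a + 1ℚ * (ℕ→ℚ (suc m) - b))
               (edgeSum-zero (suc m) _ (λ i j → ℚP.*-zeroˡ (spokeWeights y i j)))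
               (trans (edgeSum-spokes m (spokeWeights y) (λ _ _ → refl)) (sumFin-const m y)) ⟩
    0ℚ + 1ℚ * (ℕ→ℚ (suc m) - ℕ→ℚ m * y)
      ≡⟨ trans (ℚP.+-identityˡ _) (ℚP.*-identityˡ _) ⟩
    ℕ→ℚ (suc m) - ℕ→ℚ m * y ∎

  0≤lpValue-spokeWeights : ∀ {y} → y ≤ℚ 1ℚ → 0ℚ ≤ℚ lpValue star (spokeWeights y)
  0≤lpValue-spokeWeights {y} y≤1 = subst (0ℚ ≤ℚ_) (sym (lpValue-spokeWeights y)) (0≤p-q (begin
    ℕ→ℚ m * y    ≤⟨ ℚP.*-monoˡ-≤-nonNeg (ℕ→ℚ m) {{ℚ.nonNegative (ℕ→ℚ-mono {0} {m} z≤n)}} y≤1 ⟩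
    ℕ→ℚ m * 1ℚ   ≡⟨ ℚP.*-identityʳ _ ⟩
    ℕ→ℚ m        ≤⟨ ℕ→ℚ-mono (ℕP.n≤1+n m) ⟩
    ℕ→ℚ (suc m)  ∎))

  coverCost-star : ∀ k F → coverCost star k F ≡ ℕ→ℚ k
  coverCost-star k F = begin-equality
    edgeSum (suc m) (λ i j → restrict (F i j) 0ℚ) + 1ℚ * ℕ→ℚ k
      ≡⟨ cong (_+ 1ℚ * ℕ→ℚ k)
              (edgeSum-zero (suc m) _ (λ i j → restrict-zero (F i j) refl)) ⟩
    0ℚ + 1ℚ * ℕ→ℚ k  ≡⟨ trans (ℚP.+-identityˡ _) (ℚP.*-identityˡ _) ⟩
    ℕ→ℚ k            ∎

  module _ (1<s+s : 1ℚ < s + s) {k} {F : EdgeSet (suc m)} {comp : Fin (suc m) → Fin k}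
           (cover : TreeCover star k F comp) where

    private
      s+s≰1 : ¬ (s + s ≤ℚ 1ℚ)
      s+s≰1 s+s≤1 = ℚP.<-irrefl refl (ℚP.<-≤-trans 1<s+s s+s≤1)

      noLeafEdge : ∀ {a b} → a Fin.< b → F (fs a) (fs b) ≢ true
      noLeafEdge a<b Fab = s+s≰1 (subst (_≤ℚ 1ℚ) (leafLoad (<⇒≢ a<b))
        (coveredEdge-load≤1 star cover (s≤s a<b) Fab))

      noTwoSpokes : ∀ {a b} → a ≢ b → F fz (fs a) ≡ true → F fz (fs b) ≡ true → ⊥
      noTwoSpokes {a} {b} a≢b Fa Fb = s+s≰1 (subst (_≤ℚ 1ℚ) (cong₂ _+_ (spokeLoad a) (spokeLoad b))
        (twoCoveredEdges-load≤1 star cover (s≤s z≤n) (s≤s z≤n) (a≢b ∘ suc-injective) Fa Fb))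

      leafEdge⇒spoke : ∀ a v → HasEdge F (fs a) v → F fz (fs a) ≡ true
      leafEdge⇒spoke a fz     (inj₁ (() , _))
      leafEdge⇒spoke a fz     (inj₂ (_ , Fa)) = Fa
      leafEdge⇒spoke a (fs b) (inj₁ (s≤s a<b , Fab)) = ⊥-elim (noLeafEdge a<b Fab)
      leafEdge⇒spoke a (fs b) (inj₂ (s≤s b<a , Fba)) = ⊥-elim (noLeafEdge b<a Fba)

      leafPath⇒spoke : ∀ {a b} → a ≢ b → Conn F (fs a) (fs b) → F fz (fs a) ≡ true
      leafPath⇒spoke a≢b here       = ⊥-elim (a≢b refl)
      leafPath⇒spoke _   (step e _) = leafEdge⇒spoke _ _ e

      leafTree-injective : ∀ {a b} → comp (fs a) ≡ comp (fs b) → a ≡ b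
      leafTree-injective {a} {b} same with a ≟ b
      ... | yes a≡b = a≡b
      ... | no  a≢b = ⊥-elim (noTwoSpokes a≢b
              (leafPath⇒spoke a≢b (Equivalence.to (components (fs a) (fs b)) same))
              (leafPath⇒spoke (≢-sym a≢b) (Equivalence.to (components (fs b) (fs a)) (sym same))))
        where open SpanningForest (TreeCover.forest cover)

    leaves≤trees : m ≤ k
    leaves≤trees = injective⇒≤ leafTree-injective

-- With w = 1/(d+1), the choices s = 1/2 + w/9, y = 2/3 - w/9 and m = 27 (d+1)² make
-- (3 - w) (1 + m (1 - y)) exactly m - w: the term of order m w cancels, and the one of order
-- m w² is the constant 3.
module GapParameters (d : ℕ) where

  w ε s y : ℚ
  w = unitFraction d
  ε = w * (+ 1 / 9)
  s = + 1 / 2 + ε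
  y = + 2 / 3 - ε

  m : ℕ
  m = 27 ℕ.* (suc d ℕ.* suc d)

  0<w : 0ℚ < w
  0<w = 0<unitFraction d

  0<ε : 0ℚ < ε
  0<ε = ℚP.*-monoˡ-<-pos (+ 1 / 9) 0<w

  0≤ε : 0ℚ ≤ℚ ε
  0≤ε = ℚP.<⇒≤ 0<ε

  ε≤2/3 : ε ≤ℚ + 2 / 3
  ε≤2/3 = begin
    w * (+ 1 / 9)   ≤⟨ ℚP.*-monoʳ-≤-nonNeg (+ 1 / 9) (unitFraction≤1 d) ⟩
    + 1 / 9         ≤⟨ ℚP.≤ᵇ⇒≤ {+ 1 / 9} {+ 2 / 3} _ ⟩
    + 2 / 3         ∎

  0≤s : 0ℚ ≤ℚ s
  0≤s = ℚP.+-mono-≤ (ℚP.nonNegative⁻¹ (+ 1 / 2)) 0≤ε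

  1<s+s : 1ℚ < s + s
  1<s+s = ℚP.+-mono-< 1/2<s 1/2<s
    where
    1/2<s : + 1 / 2 < s
    1/2<s = ℚP.+-monoʳ-< (+ 1 / 2) 0<ε

  0≤y : 0ℚ ≤ℚ y
  0≤y = 0≤p-q ε≤2/3

  y≤1 : y ≤ℚ 1ℚ
  y≤1 = ℚP.≤-trans (p-q≤p (+ 2 / 3) 0≤ε) (ℚP.≤ᵇ⇒≤ {+ 2 / 3} {1ℚ} _)

  spoke≤1 : (1ℚ + s) * y ≤ℚ 1ℚ
  spoke≤1 = begin
    (1ℚ + s) * y
      ≡⟨ solve 1 (λ ε → (con 1ℚ :+ (con (+ 1 / 2) :+ ε)) :* (con (+ 2 / 3) :- ε)
                        := con 1ℚ :- ε :* (con (+ 5 / 6) :+ ε)) refl ε ⟩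
    1ℚ - ε * (+ 5 / 6 + ε)
      ≤⟨ p-q≤p 1ℚ (0≤p*q 0≤ε (ℚP.+-mono-≤ (ℚP.nonNegative⁻¹ (+ 5 / 6)) 0≤ε)) ⟩
    1ℚ
      ∎
    where open ℚSolver.+-*-Solver

  gap : (ℕ→ℚ 3 - w) * (ℕ→ℚ (suc m) - ℕ→ℚ m * y) ≡ ℕ→ℚ m - w
  gap = begin-equality
    (ℕ→ℚ 3 - w) * (ℕ→ℚ (suc m) - ℕ→ℚ m * y)
      ≡⟨ cong (λ a → (ℕ→ℚ 3 - w) * (a - ℕ→ℚ m * y)) (ℕ→ℚ-+ 1 m) ⟩
    (ℕ→ℚ 3 - w) * ((1ℚ + ℕ→ℚ m) - ℕ→ℚ m * y)
      ≡⟨ cong (λ M → (ℕ→ℚ 3 - w) * ((1ℚ + M) - M * y)) m≡27DD ⟩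
    (ℕ→ℚ 3 - w) * ((1ℚ + 27DD) - 27DD * y)
      ≡⟨ solve 2 (λ D w →
           let 27DD = con (ℕ→ℚ 27) :* (D :* D) in
           (con (ℕ→ℚ 3) :- w) :* ((con 1ℚ :+ 27DD) :- 27DD :* (con (+ 2 / 3) :- w :* con (+ 1 / 9)))
           := (27DD :- w) :+ con (ℕ→ℚ 3) :* (con 1ℚ :- (D :* w) :* (D :* w))) refl D w ⟩
    (27DD - w) + ℕ→ℚ 3 * (1ℚ - (D * w) * (D * w))
      ≡⟨ cong (λ r → (27DD - w) + ℕ→ℚ 3 * (1ℚ - r * r)) (unitFraction-inverse d) ⟩
    (27DD - w) + 0ℚ
      ≡⟨ ℚP.+-identityʳ _ ⟩
    27DD - w
      ≡⟨ cong (_- w) m≡27DD ⟨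
    ℕ→ℚ m - w
      ∎
    where
    open ℚSolver.+-*-Solver
    D 27DD : ℚ
    D = ℕ→ℚ (suc d)
    27DD = ℕ→ℚ 27 * (D * D)
    m≡27DD : ℕ→ℚ m ≡ 27DD
    m≡27DD = trans (ℕ→ℚ-* 27 (suc d ℕ.* suc d)) (cong (ℕ→ℚ 27 *_) (ℕ→ℚ-* (suc d) (suc d)))

theorem9 : ∀ (ρ : ℚ) → ρ < ℕ→ℚ 3 →
    Σ ℕ λ n → 1 ≤ n × Σ (Instance n) λ I →
      Σ (Fin n → Fin n → ℚ) λ x → LPFeasible I x ×
        (∀ (k : ℕ) (F : EdgeSet n) (comp : Fin n → Fin k) →
          TreeCover I k F comp → ρ * lpValue I x < coverCost I k F)
theorem9 ρ ρ<3 =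
  suc m , s≤s z≤n , star , spokeWeights y , spokeWeights-feasible 0≤y y≤1 spoke≤1 , beatsLP
  where
  open GapParameters (ℚ.denominator-1 ρ)
  open Star m s 0≤s

  LP : ℚ
  LP = lpValue star (spokeWeights y)

  0≤LP : 0ℚ ≤ℚ LP
  0≤LP = 0≤lpValue-spokeWeights y≤1

  ρ≤3-w : ρ ≤ℚ ℕ→ℚ 3 - w
  ρ≤3-w = p+q≤r⇒p≤r-q {ρ} {w} (<ℕ⇒+unitFraction≤ℕ 3 ρ<3)

  beatsLP : ∀ k F comp → TreeCover star k F comp → ρ * LP < coverCost star k F
  beatsLP k F comp cover = begin-strict
    ρ * LP              ≤⟨ ℚP.*-monoʳ-≤-nonNeg LP {{ℚ.nonNegative 0≤LP}} ρ≤3-w ⟩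
    (ℕ→ℚ 3 - w) * LP   ≡⟨ cong ((ℕ→ℚ 3 - w) *_) (lpValue-spokeWeights y) ⟩
    (ℕ→ℚ 3 - w) * (ℕ→ℚ (suc m) - ℕ→ℚ m * y)
                        ≡⟨ gap ⟩
    ℕ→ℚ m - w           <⟨ p-q<p (ℕ→ℚ m) 0<w ⟩
    ℕ→ℚ m               ≤⟨ ℕ→ℚ-mono (leaves≤trees 1<s+s cover) ⟩
    ℕ→ℚ k               ≡⟨ coverCost-star k F ⟨
    coverCost star k F  ∎
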